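{- Let $n\geq 1$. If $\alpha=(a_1,a_2,\ldots,a_n)\in[n]^n$ is a non-decreasing vacillating parking function of length $n$ (i.e. $a_1\leq a_2\leq\cdots\leq a_n$), then $i-1\leq a_i\leq i+1$ for all $i\in[n]$.
   Context: For $n\in\mathbb{N}$ let $[n]=\{1,\dots,n\}$. A preference list $\alpha=(a_1,\dots,a_n)\in[n]^n$ describes $n$ cars entering, in order $i=1,\dots,n$, a one-way street with spots $1,\dots,n$; car $i$ prefers spot $a_i$. Under the vacillating parking rule, car $i$ parks in spot $a_i$ if unoccupied; otherwise in spot $a_i-1$ if it exists and is unoccupied; otherwise in spot $a_i+1$ if it exists and is unoccupied; otherwise it fails to park. If all cars park, $\alpha$ is a vacillating parking function of length $n$. -}

module Defs where

open import Data.Nat using (ℕ; zero; suc; _≤_; _<_; _∸_; _≟_; _≤?_)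
open import Data.Bool using (Bool; true; false; _∨_; if_then_else_)
open import Data.List using (List; []; _∷_)
open import Data.Maybe using (Maybe; just; nothing; _>>=_)
open import Data.Vec using (Vec; []; _∷_; toList)
open import Relation.Nullary.Decidable using (⌊_⌋)

-- Spots are the naturals 1..n; a preference list is a vector of naturals
-- (membership in [n]^n is imposed separately by InRange).

occupied : ℕ → List ℕ → Bool
occupied s [] = false
occupied s (t ∷ ts) = ⌊ s ≟ t ⌋ ∨ occupied s ts

free : ℕ → ℕ → List ℕ → Bool
free n s occ with ⌊ 1 ≤? s ⌋ | ⌊ s ≤? n ⌋ | occupied s occ
... | true | true | false = true
... | _    | _    | _     = false

parkOne : ℕ → List ℕ → ℕ → Maybe (List ℕ)
parkOne n occ a =
  if free n a occ then just (a ∷ occ)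
  else if free n (a ∸ 1) occ then just ((a ∸ 1) ∷ occ)
  else if free n (suc a) occ then just (suc a ∷ occ)
  else nothing

parkAll : ℕ → List ℕ → List ℕ → Maybe (List ℕ)
parkAll n occ [] = just occ
parkAll n occ (a ∷ as) = parkOne n occ a >>= λ occ' → parkAll n occ' as

data IsJust {A : Set} : Maybe A → Set where
  isJust : ∀ {x} → IsJust (just x)

InRange : ∀ {n} → Vec ℕ n → Set
InRange {n} α = ∀ i → 1 ≤ Data.Vec.lookup α i × Data.Vec.lookup α i ≤ n
  where open import Data.Product using (_×_)

IsVacillatingPF : ∀ {n} → Vec ℕ n → Set
IsVacillatingPF {n} α = InRange α × IsJust (parkAll n [] (toList α))
  where open import Data.Product using (_×_)

NonDecreasing : ∀ {n} → Vec ℕ n → Set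
NonDecreasing {n} α = ∀ (i j : Fin n) → toℕ i ≤ toℕ j → Data.Vec.lookup α i ≤ Data.Vec.lookup α j
  where open import Data.Fin using (Fin; toℕ)

-- Every car parks within one spot of its preference. If a_i < i - 1, the first i
-- cars all prefer spots below i - 1 and hence park in [1, i - 1]; if a_i > i + 1,
-- the last n - i + 1 cars all prefer spots from i + 2 on and hence park in [i + 1, n].
-- Either way more cars than spots, contradicting the pigeonhole principle for the
-- distinct occupied spots.
module Submission where

open import Level using (Level)
open import Defs
open import Data.Nat using (ℕ; zero; suc; _+_; _⊓_; _≤_; _<_; _∸_; _≟_; _≤?_; z≤n; s≤s)
open import Data.Nat.Properties
open import Data.Fin using (Fin; toℕ) renaming (zero to fzero; suc to fsuc)
open import Data.Fin.Properties using (toℕ<n)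
open import Data.Vec using (Vec; lookup; toList) renaming ([] to []ᵥ; _∷_ to _∷ᵥ_)
open import Data.Vec.Properties using (length-toList)
open import Data.List using (List; []; _∷_; _++_; length; take; drop; applyUpTo)
open import Data.List.Properties
  using (length-take; length-drop; take++drop≡id; ++-assoc; length-++; length-applyUpTo; length-removeAt′)
open import Data.List.Relation.Unary.All as All using (All; []; _∷_)
import Data.List.Relation.Unary.All.Properties as All
open import Data.List.Relation.Unary.Any using (Any; here; there; index; _─_)
open import Data.List.Relation.Unary.AllPairs using ([]; _∷_)
open import Data.List.Relation.Unary.Unique.Propositional using (Unique)
open import Data.List.Membership.Propositional using (_∈_)
open import Data.List.Membership.Propositional.Properties using (∈-applyUpTo⁺)
open import Data.List.Relation.Binary.Subset.Propositional using (_⊆_)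
open import Data.Product using (_×_; _,_; ∃-syntax; ∃₂; uncurry)
open import Data.Maybe using (Maybe; just; nothing)
open import Data.Bool using (true; false)
open import Relation.Nullary using (yes; no; contradiction)
open import Relation.Binary.PropositionalEquality

private
  variable
    ℓ : Level
    A : Set ℓ

∈-─ : ∀ {x y : A} {ys} (x∈ys : x ∈ ys) → y ∈ ys → x ≢ y → y ∈ (ys ─ x∈ys)
∈-─ (here refl) (here refl)  x≢y = contradiction refl x≢y
∈-─ (here _)    (there y∈ys) _   = y∈ys
∈-─ (there _)   (here refl)  _   = here refl
∈-─ (there x∈ys) (there y∈ys) x≢y = there (∈-─ x∈ys y∈ys x≢y)

Unique-⊆⇒length≤ : ∀ {xs ys : List A} → Unique xs → xs ⊆ ys → length xs ≤ length ys
Unique-⊆⇒length≤ [] _ = z≤n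
Unique-⊆⇒length≤ {xs = x ∷ xs} {ys} (x≢xs ∷ xs-unique) xs⊆ys = begin
  suc (length xs)          ≤⟨ s≤s (Unique-⊆⇒length≤ xs-unique xs⊆ys─x) ⟩
  suc (length (ys ─ x∈ys)) ≡⟨ length-removeAt′ ys (index x∈ys) ⟨
  length ys                ∎
  where
  open ≤-Reasoning
  x∈ys : x ∈ ys
  x∈ys = xs⊆ys (here refl)
  xs⊆ys─x : xs ⊆ (ys ─ x∈ys)
  xs⊆ys─x y∈xs = ∈-─ x∈ys (xs⊆ys (there y∈xs)) (All.lookup x≢xs y∈xs)

Unique-++⁻ˡ : ∀ (xs : List A) {ys} → Unique (xs ++ ys) → Unique xs
Unique-++⁻ˡ []       _               = []
Unique-++⁻ˡ (x ∷ xs) (x≢xs ∷ unique) = All.++⁻ˡ xs x≢xs ∷ Unique-++⁻ˡ xs unique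

interval : ℕ → ℕ → List ℕ
interval lo hi = applyUpTo (lo +_) (suc hi ∸ lo)

∈-interval⁺ : ∀ {lo hi s} → lo ≤ s → s ≤ hi → s ∈ interval lo hi
∈-interval⁺ {lo} {hi} lo≤s s≤hi =
  subst (_∈ interval lo hi) (m+[n∸m]≡n lo≤s) (∈-applyUpTo⁺ (lo +_) (∸-monoˡ-< (s≤s s≤hi) lo≤s))

length-interval : ∀ lo hi → length (interval lo hi) ≡ suc hi ∸ lo
length-interval lo hi = length-applyUpTo (lo +_) (suc hi ∸ lo)

Admissible : ℕ → ℕ → ℕ → Set
Admissible n a s = (1 ≤ s × s ≤ n) × (a ∸ 1 ≤ s × s ≤ suc a)

occupied≡false⇒≢ : ∀ {s} xs → occupied s xs ≡ false → All (s ≢_) xs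
occupied≡false⇒≢ [] _ = []
occupied≡false⇒≢ {s} (t ∷ ts) vacant with s ≟ t
... | no s≢t = s≢t ∷ occupied≡false⇒≢ ts vacant
occupied≡false⇒≢ (t ∷ ts) () | yes _

free⇒Admissible : ∀ n occ s {a} → free n s occ ≡ true → a ∸ 1 ≤ s → s ≤ suc a →
  Admissible n a s × occupied s occ ≡ false
free⇒Admissible n occ s free-s near-below near-above with 1 ≤? s | s ≤? n | occupied s occ
... | yes 1≤s | yes s≤n | false = ((1≤s , s≤n) , (near-below , near-above)) , refl
free⇒Admissible n occ s () _ _ | yes _ | yes _ | true
free⇒Admissible n occ s () _ _ | yes _ | no _  | _
free⇒Admissible n occ s () _ _ | no _  | _     | _

parkOne≡just : ∀ n occ a {r} → parkOne n occ a ≡ just r →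
  ∃[ s ] r ≡ s ∷ occ × Admissible n a s × occupied s occ ≡ false
parkOne≡just n occ a parked with free n a occ in free-a
... | true with refl ← parked = a , refl , free⇒Admissible n occ a free-a (m∸n≤m a 1) (n≤1+n a)
... | false with free n (a ∸ 1) occ in free-a-1
...   | true with refl ← parked =
        a ∸ 1 , refl , free⇒Admissible n occ (a ∸ 1) free-a-1 ≤-refl (≤-trans (m∸n≤m a 1) (n≤1+n a))
...   | false with free n (suc a) occ in free-a+1
...     | true with refl ← parked =
          suc a , refl , free⇒Admissible n occ (suc a) free-a+1 (≤-trans (m∸n≤m a 1) (n≤1+n a)) ≤-refl
parkOne≡just n occ a () | false | false | false

parkAll-∷ : ∀ n occ a as {r} → parkAll n occ (a ∷ as) ≡ just r →
  ∃[ s ] Admissible n a s × occupied s occ ≡ false × parkAll n (s ∷ occ) as ≡ just r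
parkAll-∷ n occ a as parked with parkOne n occ a in parked-a
... | just _ with s , refl , admissible , vacant ← parkOne≡just n occ a parked-a =
  s , admissible , vacant , parked
parkAll-∷ n occ a as () | nothing

parkAll-++ : ∀ {n occ} xs {ys r} → parkAll n occ (xs ++ ys) ≡ just r →
  ∃[ o ] parkAll n occ xs ≡ just o × parkAll n o ys ≡ just r
parkAll-++ [] parked = _ , refl , parked
parkAll-++ {n} {occ} (x ∷ xs) parked with parkOne n occ x
... | just o = parkAll-++ xs parked
parkAll-++ (x ∷ xs) () | nothing

parkAll-Unique : ∀ {n occ} as {r} → parkAll n occ as ≡ just r → Unique occ → Unique r
parkAll-Unique [] refl occ-unique = occ-unique
parkAll-Unique {n} {occ} (a ∷ as) parked occ-unique
  with s , _ , vacant , parked′ ← parkAll-∷ n occ a as parked =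
  parkAll-Unique as parked′ (occupied≡false⇒≢ _ vacant ∷ occ-unique)

parkAll-spots : ∀ {n occ} as {r} → parkAll n occ as ≡ just r →
  ∃[ ss ] r ≡ ss ++ occ × length ss ≡ length as × All (λ s → Any (λ a → Admissible n a s) as) ss
parkAll-spots [] refl = [] , refl , refl , []
parkAll-spots {n} {occ} (a ∷ as) parked
  with s , admissible , _ , parked′ ← parkAll-∷ n occ a as parked
  with ss , refl , length-ss , ss-admissible ← parkAll-spots as parked′ =
  ss ++ s ∷ [] ,
  sym (++-assoc ss (s ∷ []) occ) ,
  trans (length-++ ss) (trans (+-comm (length ss) 1) (cong suc length-ss)) ,
  All.++⁺ (All.map there ss-admissible) (here admissible ∷ [])

parkAll-length≤ : ∀ {n occ as r lo hi} {P : ℕ → Set} →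
  parkAll n occ as ≡ just r → Unique occ → All P as →
  (∀ {a s} → P a → Admissible n a s → lo ≤ s × s ≤ hi) →
  length as ≤ suc hi ∸ lo
parkAll-length≤ {as = as} {lo = lo} {hi} parked occ-unique as-P confined
  with ss , refl , length-ss , ss-admissible ← parkAll-spots as parked = begin
  length as               ≡⟨ length-ss ⟨
  length ss               ≤⟨ Unique-⊆⇒length≤ ss-unique ss⊆interval ⟩
  length (interval lo hi) ≡⟨ length-interval lo hi ⟩
  suc hi ∸ lo             ∎
  where
  open ≤-Reasoning
  ss-unique = Unique-++⁻ˡ ss (parkAll-Unique as parked occ-unique)
  ss⊆interval : ss ⊆ interval lo hi
  ss⊆interval s∈ss =
    uncurry ∈-interval⁺ (uncurry confined (All.lookupAny as-P (All.lookup ss-admissible s∈ss)))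

All-take-toList : ∀ {P : A → Set} {n} (α : Vec A n) m →
  (∀ j → toℕ j < m → P (lookup α j)) → All P (take m (toList α))
All-take-toList _        zero    _ = []
All-take-toList []ᵥ      (suc m) _ = []
All-take-toList (x ∷ᵥ α) (suc m) P-prefix =
  P-prefix fzero (s≤s z≤n) ∷ All-take-toList α m (λ j j<m → P-prefix (fsuc j) (s≤s j<m))

All-drop-toList : ∀ {P : A → Set} {n} (α : Vec A n) m →
  (∀ j → m ≤ toℕ j → P (lookup α j)) → All P (drop m (toList α))
All-drop-toList []ᵥ      zero    _ = []
All-drop-toList []ᵥ      (suc m) _ = []
All-drop-toList (x ∷ᵥ α) zero    P-all =
  P-all fzero z≤n ∷ All-drop-toList α zero (λ j _ → P-all (fsuc j) z≤n)
All-drop-toList (x ∷ᵥ α) (suc m) P-suffix =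
  All-drop-toList α m (λ j m≤j → P-suffix (fsuc j) (s≤s m≤j))

length-take-toList : ∀ {n} (α : Vec A n) {m} → m ≤ n → length (take m (toList α)) ≡ m
length-take-toList α {m} m≤n =
  trans (length-take m (toList α)) (trans (cong (m ⊓_) (length-toList α)) (m≤n⇒m⊓n≡m m≤n))

length-drop-toList : ∀ {n} (α : Vec A n) m → length (drop m (toList α)) ≡ n ∸ m
length-drop-toList α m = trans (length-drop m (toList α)) (cong (_∸ m) (length-toList α))

IsJust⇒≡just : ∀ {x : Maybe A} → IsJust x → ∃[ y ] x ≡ just y
IsJust⇒≡just isJust = _ , refl

IsVacillatingPF⇒parkAll-split : ∀ {n} (α : Vec ℕ n) → IsVacillatingPF α → ∀ m →
  ∃₂ λ o r → parkAll n [] (take m (toList α)) ≡ just o × parkAll n o (drop m (toList α)) ≡ just r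
IsVacillatingPF⇒parkAll-split {n} α (_ , parks) m
  with r , parked ← IsJust⇒≡just parks
  with o , first , rest ←
         parkAll-++ (take m (toList α)) (trans (cong (parkAll n []) (take++drop≡id m (toList α))) parked) =
  o , r , first , rest

toℕ≤lookup : ∀ {n} (α : Vec ℕ n) → NonDecreasing α → IsVacillatingPF α →
  ∀ i → toℕ i ≤ lookup α i
toℕ≤lookup {n} α nondecreasing vpf i
  with _ , _ , first , _ ← IsVacillatingPF⇒parkAll-split α vpf (suc (toℕ i)) =
  ≮⇒≥ λ aᵢ<k → 1+n≰n (begin
    suc k                            ≡⟨ length-take-toList α (toℕ<n i) ⟨
    length (take (suc k) (toList α)) ≤⟨ parkAll-length≤ first [] (prefix-below aᵢ<k) confined ⟩
    k                                ∎)
  where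
  open ≤-Reasoning
  k = toℕ i
  prefix-below : lookup α i < k → All (_< k) (take (suc k) (toList α))
  prefix-below aᵢ<k =
    All-take-toList α (suc k) (λ j j≤k → ≤-<-trans (nondecreasing j i (≤-pred j≤k)) aᵢ<k)
  confined : ∀ {a s} → a < k → Admissible n a s → 1 ≤ s × s ≤ k
  confined a<k ((1≤s , _) , (_ , s≤1+a)) = 1≤s , ≤-trans s≤1+a a<k

lookup≤2+toℕ : ∀ {n} (α : Vec ℕ n) → NonDecreasing α → IsVacillatingPF α →
  ∀ i → lookup α i ≤ 2 + toℕ i
lookup≤2+toℕ {n} α nondecreasing vpf i
  with _ , _ , first , rest ← IsVacillatingPF⇒parkAll-split α vpf (toℕ i) =
  ≮⇒≥ λ 2+k<aᵢ → <⇒≱ (∸-monoʳ-< (n<1+n k) (toℕ<n i)) (begin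
    n ∸ k                      ≡⟨ length-drop-toList α k ⟨
    length (drop k (toList α)) ≤⟨ parkAll-length≤ rest first-unique (suffix-above 2+k<aᵢ) confined ⟩
    n ∸ suc k                  ∎)
  where
  open ≤-Reasoning
  k = toℕ i
  first-unique = parkAll-Unique (take k (toList α)) first []
  suffix-above : 2 + k < lookup α i → All (2 + k <_) (drop k (toList α))
  suffix-above 2+k<aᵢ = All-drop-toList α k (λ j k≤j → <-≤-trans 2+k<aᵢ (nondecreasing i j k≤j))
  confined : ∀ {a s} → 2 + k < a → Admissible n a s → 2 + k ≤ s × s ≤ n
  confined 2+k<a ((_ , s≤n) , (a∸1≤s , _)) = ≤-trans (∸-monoˡ-≤ 1 2+k<a) a∸1≤s , s≤n

-- The hypothesis 1 ≤ n is implied by the existence of i : Fin n.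
lemma3p1 : (n : ℕ) → 1 ≤ n → (α : Vec ℕ n) →
    NonDecreasing α → IsVacillatingPF α →
    (i : Fin n) → (suc (toℕ i) ∸ 1 ≤ lookup α i) × (lookup α i ≤ suc (toℕ i) + 1)
lemma3p1 n _ α nondecreasing vpf i =
  toℕ≤lookup α nondecreasing vpf i ,
  subst (lookup α i ≤_) (+-comm 1 (suc (toℕ i))) (lookup≤2+toℕ α nondecreasing vpf i)
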